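{- For all $n,m$: there exists a 4-graph of order $n$ and size $m$ in which exactly one pair of distinct edges intersects in at least two points, and that pair intersects in exactly three points, if and only if there exists a 2-$(n,4,1)$ packing of size $m-2$ whose leave contains $K_5-e$ as a subgraph.
   Context: A 4-graph is a pair $(X,\mathcal{A})$ with $X$ a finite vertex set and $\mathcal{A}$ a set of 4-subsets of $X$ (edges); order $=|X|$, size $=|\mathcal{A}|$. A 2-$(n,4,1)$ packing is a 4-graph of order $n$ in which every 2-subset lies in at most one edge (block); its leave is the graph whose edges are the 2-subsets contained in no block. $K_5-e$ is $K_5$ minus one edge. -}

module Defs where

open import Data.Nat using (ℕ; _≤_; _+_)
open import Data.Fin using (Fin; zero; suc)
open import Data.Fin.Subset using (Subset; _∈_; _∩_; ∣_∣)
open import Data.Product using (Σ; ∃; _×_)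
open import Data.Sum using (_⊎_)
open import Relation.Binary.PropositionalEquality using (_≡_; _≢_)
open import Relation.Nullary using (¬_)

IsFourGraph : (n m : ℕ) → (Fin m → Subset n) → Set
IsFourGraph n m E = (∀ i → ∣ E i ∣ ≡ 4) × (∀ i j → E i ≡ E j → i ≡ j)

UniqueTriplePair : ∀ {n m} → (Fin m → Subset n) → Set
UniqueTriplePair {n} {m} E =
  Σ (Fin m) λ i → Σ (Fin m) λ j →
    i ≢ j × ∣ E i ∩ E j ∣ ≡ 3 ×
    (∀ k l → k ≢ l → 2 ≤ ∣ E k ∩ E l ∣ → (k ≡ i × l ≡ j) ⊎ (k ≡ j × l ≡ i))

IsPacking : (n k : ℕ) → (Fin k → Subset n) → Set
IsPacking n k P = IsFourGraph n k P ×
  (∀ x y → x ≢ y → ∀ i j → x ∈ P i → y ∈ P i → x ∈ P j → y ∈ P j → i ≡ j)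

InLeave : ∀ {n k} → (Fin k → Subset n) → Fin n → Fin n → Set
InLeave P x y = x ≢ y × (∀ i → ¬ (x ∈ P i × y ∈ P i))

K5-e-adj : Fin 5 → Fin 5 → Set
K5-e-adj a b = a ≢ b × ¬ ((a ≡ zero × b ≡ suc zero) ⊎ (a ≡ suc zero × b ≡ zero))

LeaveContainsK5-e : ∀ {n k} → (Fin k → Subset n) → Set
LeaveContainsK5-e {n} P =
  Σ (Fin 5 → Fin n) λ f → (∀ a b → f a ≡ f b → a ≡ b) ×
    (∀ a b → K5-e-adj a b → InLeave P (f a) (f b))

module Submission where

-- Call two 4-sets S, T of vertices *twin blocks* for a packing P when
-- |S ∩ T| = 3 and every pair of distinct points inside S or inside T is an edge of
-- the leave of P.  The theorem follows from three facts:
--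
--  * Deletion: in a 4-graph whose only pair of edges meeting in ≥ 2 points is
--    {E i, E j}, with |E i ∩ E j| = 3, the remaining edges form a packing, and
--    E i, E j are twin blocks for it (any pair inside them lies in no other edge).
--  * Extension: conversely, adding twin blocks S, T to a packing P gives a 4-graph
--    in which {S, T} is the unique pair of edges meeting in ≥ 2 points.
--  * The leave of P contains K5 - e iff P has twin blocks: K5 - e is the union of
--    two 4-cliques meeting in three vertices, so an embedded K5 - e yields twin
--    blocks as the images of these cliques, and twin blocks S = {a,x,y,z},
--    T = {e,x,y,z} span a K5 - e whose missing edge is {a, e}.

open import Defs
open import Data.Nat using (ℕ; zero; suc; _≤_; _<_; _+_; z≤n; s≤s; s≤s⁻¹)
open import Data.Nat.Properties using (+-suc; +-comm; <⇒≱; ≤-refl; ≤-reflexive)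
open import Data.Fin using (Fin; zero; suc; _≟_; punchIn; punchOut)
open import Data.Fin.Properties
  using (any?; suc-injective; punchIn-injective; punchInᵢ≢i; punchIn-punchOut)
open import Data.Fin.Subset
  using (Subset; _⊆_; inside; outside; _∈_; _∉_; _∩_; _∪_; _-_; _─_; ⁅_⁆; ⊥; ⊤; ∣_∣; Nonempty)
open import Data.Fin.Subset.Properties
  using ( _∈?_; nonempty?; Empty-unique; ∣⊥∣≡0; ∣⁅x⁆∣≡1; p⊆q⇒∣p∣≤∣q∣; p─⊥≡p; p─q⊆p
        ; x∈⁅x⁆; x∈⁅y⁆⇒x≡y; x∈p∧x≢y⇒x∈p-y; x∈p∩q⁺; x∈p∩q⁻; x∈p∪q⁺; x∈p∪q⁻
        ; ∉⊥; ∈⊤; ⊆-antisym; ∩-comm; ∩-idem )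
open import Data.Vec using (Vec; _∷_; []; here; there; lookup)
open import Data.Vec.Relation.Unary.All using (_∷_; [])
open import Data.Vec.Relation.Unary.AllPairs using (_∷_; [])
open import Data.Vec.Relation.Unary.Unique.Propositional using (Unique)
open import Data.Vec.Relation.Unary.Unique.Propositional.Properties using (lookup-injective)
open import Data.Product using (Σ; ∃-syntax; _×_; _,_; proj₁; proj₂)
open import Data.Sum using (_⊎_; inj₁; inj₂)
open import Function using (_∘_; Injective; _⇔_; mk⇔; Equivalence)
open import Relation.Binary.PropositionalEquality
  using (_≡_; _≢_; ≢-sym; refl; sym; trans; cong; cong₂; subst; subst₂; module ≡-Reasoning)
open import Relation.Nullary using (¬_; yes; no; contradiction)
open import Relation.Nullary.Decidable using (_×-dec_; ¬?)

x∈p─q⇒x∉q : ∀ {n} {p q : Subset n} {x : Fin n} → x ∈ p ─ q → x ∉ q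
x∈p─q⇒x∉q {p = _ ∷ _} {outside ∷ _} here       ()
x∈p─q⇒x∉q {p = _ ∷ _} {_ ∷ _}       (there x∈) (there x∈q) = x∈p─q⇒x∉q x∈ x∈q

x∈p-y⇒x≢y : ∀ {n} {p : Subset n} {x y : Fin n} → x ∈ p - y → x ≢ y
x∈p-y⇒x≢y x∈ refl = x∈p─q⇒x∉q x∈ (x∈⁅x⁆ _)

∣p∣≡1+∣p-x∣ : ∀ {n} {p : Subset n} {x : Fin n} → x ∈ p → ∣ p ∣ ≡ suc ∣ p - x ∣
∣p∣≡1+∣p-x∣ {p = inside ∷ p}  here        = cong suc (sym (cong ∣_∣ (p─⊥≡p p)))
∣p∣≡1+∣p-x∣ {p = outside ∷ p} (there x∈p) = ∣p∣≡1+∣p-x∣ x∈p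
∣p∣≡1+∣p-x∣ {p = inside ∷ p}  (there x∈p) = cong suc (∣p∣≡1+∣p-x∣ x∈p)

member : ∀ {n c} (p : Subset n) → suc c ≤ ∣ p ∣ → Nonempty p
member {n} p 0<∣p∣ with nonempty? p
... | yes nonempty = nonempty
... | no empty
  with () ← subst (λ s → suc _ ≤ s) (trans (cong ∣_∣ (Empty-unique empty)) (∣⊥∣≡0 n)) 0<∣p∣

pick : ∀ {n c} (p : Subset n) → suc c ≤ ∣ p ∣ → ∃[ x ] x ∈ p × c ≤ ∣ p - x ∣
pick p c<∣p∣ with member p c<∣p∣
... | x , x∈p = x , x∈p , s≤s⁻¹ (subst (_ ≤_) (∣p∣≡1+∣p-x∣ x∈p) c<∣p∣)

∈-minus : ∀ {n} {p : Subset n} {x y : Fin n} → y ∈ p - x → y ∈ p × y ≢ x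
∈-minus {p = p} {x} y∈ = p─q⊆p p ⁅ x ⁆ y∈ , x∈p-y⇒x≢y y∈

two-members : ∀ {n} (p : Subset n) → 2 ≤ ∣ p ∣ → ∃[ u ] ∃[ v ] u ≢ v × u ∈ p × v ∈ p
two-members p 2≤∣p∣ with pick p 2≤∣p∣
... | u , u∈p , 1≤ with pick (p - u) 1≤
...   | v , v∈ , _ with ∈-minus v∈
...     | v∈p , v≢u = u , v , ≢-sym v≢u , u∈p , v∈p

three-members : ∀ {n} (p : Subset n) → 3 ≤ ∣ p ∣ →
  ∃[ x ] ∃[ y ] ∃[ z ] x ≢ y × x ≢ z × y ≢ z × x ∈ p × y ∈ p × z ∈ p
three-members p 3≤∣p∣ with pick p 3≤∣p∣
... | x , x∈p , 2≤ with two-members (p - x) 2≤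
...   | y , z , y≢z , y∈ , z∈ with ∈-minus y∈ | ∈-minus z∈
...     | y∈p , y≢x | z∈p , z≢x = x , y , z , ≢-sym y≢x , ≢-sym z≢x , y≢z , x∈p , y∈p , z∈p

pair⇒2≤∣p∣ : ∀ {n} {p : Subset n} {u v : Fin n} → u ≢ v → u ∈ p → v ∈ p → 2 ≤ ∣ p ∣
pair⇒2≤∣p∣ {p = p} {u} {v} u≢v u∈p v∈p =
  subst (2 ≤_) (sym (trans (∣p∣≡1+∣p-x∣ u∈p) (cong suc (∣p∣≡1+∣p-x∣ v∈p-u)))) (s≤s (s≤s z≤n))
  where
  v∈p-u : v ∈ p - u
  v∈p-u = x∈p∧x≢y⇒x∈p-y v∈p (≢-sym u≢v)

∣p∪q∣≡∣p∣+∣q∣ : ∀ {n} (p q : Subset n) → (∀ {x} → x ∈ p → x ∉ q) → ∣ p ∪ q ∣ ≡ ∣ p ∣ + ∣ q ∣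
∣p∪q∣≡∣p∣+∣q∣ [] [] _ = refl
∣p∪q∣≡∣p∣+∣q∣ (outside ∷ p) (outside ∷ q) disjoint =
  ∣p∪q∣≡∣p∣+∣q∣ p q (λ x∈p x∈q → disjoint (there x∈p) (there x∈q))
∣p∪q∣≡∣p∣+∣q∣ (outside ∷ p) (inside ∷ q) disjoint =
  trans (cong suc (∣p∪q∣≡∣p∣+∣q∣ p q (λ x∈p x∈q → disjoint (there x∈p) (there x∈q))))
        (sym (+-suc ∣ p ∣ ∣ q ∣))
∣p∪q∣≡∣p∣+∣q∣ (inside ∷ p) (outside ∷ q) disjoint =
  cong suc (∣p∪q∣≡∣p∣+∣q∣ p q (λ x∈p x∈q → disjoint (there x∈p) (there x∈q)))
∣p∪q∣≡∣p∣+∣q∣ (inside ∷ p) (inside ∷ q) disjoint = contradiction here (disjoint here)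

∃-outside : ∀ {n} (p q : Subset n) → ∣ p ∩ q ∣ < ∣ p ∣ → ∃[ x ] x ∈ p × x ∉ q
∃-outside p q ∣p∩q∣<∣p∣ with any? (λ x → x ∈? p ×-dec ¬? (x ∈? q))
... | yes found = found
... | no none = contradiction (p⊆q⇒∣p∣≤∣q∣ p⊆p∩q) (<⇒≱ ∣p∩q∣<∣p∣)
  where
  p⊆p∩q : p ⊆ p ∩ q
  p⊆p∩q {x} x∈p with x ∈? q
  ... | yes x∈q = x∈p∩q⁺ (x∈p , x∈q)
  ... | no x∉q  = contradiction (x , x∈p , x∉q) none

∉-∈⇒≢ : ∀ {n} {p : Subset n} {u v : Fin n} → u ∉ p → v ∈ p → u ≢ v
∉-∈⇒≢ u∉p v∈p refl = u∉p v∈p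

image : ∀ {d n} → (Fin d → Fin n) → Subset d → Subset n
image f []            = ⊥
image f (outside ∷ A) = image (f ∘ suc) A
image f (inside ∷ A)  = ⁅ f zero ⁆ ∪ image (f ∘ suc) A

∈-image⁺ : ∀ {d n} (f : Fin d → Fin n) {A : Subset d} {c : Fin d} → c ∈ A → f c ∈ image f A
∈-image⁺ f {inside ∷ A}  here        = x∈p∪q⁺ (inj₁ (x∈⁅x⁆ (f zero)))
∈-image⁺ f {inside ∷ A}  (there c∈A) = x∈p∪q⁺ (inj₂ (∈-image⁺ (f ∘ suc) c∈A))
∈-image⁺ f {outside ∷ A} (there c∈A) = ∈-image⁺ (f ∘ suc) c∈A

∈-image⁻ : ∀ {d n} (f : Fin d → Fin n) (A : Subset d) {y : Fin n} →
  y ∈ image f A → ∃[ c ] c ∈ A × f c ≡ y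
∈-image⁻ f [] y∈ = contradiction y∈ ∉⊥
∈-image⁻ f (outside ∷ A) y∈ with ∈-image⁻ (f ∘ suc) A y∈
... | c , c∈A , fc≡y = suc c , there c∈A , fc≡y
∈-image⁻ f (inside ∷ A) y∈ with x∈p∪q⁻ ⁅ f zero ⁆ (image (f ∘ suc) A) y∈
... | inj₁ y∈⁅f0⁆ = zero , here , sym (x∈⁅y⁆⇒x≡y (f zero) y∈⁅f0⁆)
... | inj₂ y∈img with ∈-image⁻ (f ∘ suc) A y∈img
...   | c , c∈A , fc≡y = suc c , there c∈A , fc≡y

∣image∣ : ∀ {d n} {f : Fin d → Fin n} → Injective _≡_ _≡_ f → ∀ A → ∣ image f A ∣ ≡ ∣ A ∣
∣image∣ {n = n} f-inj [] = ∣⊥∣≡0 n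
∣image∣ f-inj (outside ∷ A) = ∣image∣ (suc-injective ∘ f-inj) A
∣image∣ {f = f} f-inj (inside ∷ A) = begin
  ∣ ⁅ f zero ⁆ ∪ image (f ∘ suc) A ∣     ≡⟨ ∣p∪q∣≡∣p∣+∣q∣ ⁅ f zero ⁆ _ f0-fresh ⟩
  ∣ ⁅ f zero ⁆ ∣ + ∣ image (f ∘ suc) A ∣ ≡⟨ cong₂ _+_ (∣⁅x⁆∣≡1 (f zero)) (∣image∣ (suc-injective ∘ f-inj) A) ⟩
  suc ∣ A ∣                               ∎
  where
  open ≡-Reasoning
  f0-fresh : ∀ {y} → y ∈ ⁅ f zero ⁆ → y ∉ image (f ∘ suc) A
  f0-fresh y∈⁅f0⁆ y∈img with ∈-image⁻ (f ∘ suc) A y∈img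
  ... | c , _ , fc≡y with () ← f-inj (trans fc≡y (x∈⁅y⁆⇒x≡y (f zero) y∈⁅f0⁆))

image-∩ : ∀ {d n} {f : Fin d → Fin n} → Injective _≡_ _≡_ f → ∀ A B →
  image f A ∩ image f B ≡ image f (A ∩ B)
image-∩ {f = f} f-inj A B = ⊆-antisym forth back
  where
  forth : image f A ∩ image f B ⊆ image f (A ∩ B)
  forth y∈ with x∈p∩q⁻ (image f A) (image f B) y∈
  ... | y∈A , y∈B with ∈-image⁻ f A y∈A | ∈-image⁻ f B y∈B
  ...   | c , c∈A , refl | d , d∈B , fd≡fc with refl ← f-inj fd≡fc = ∈-image⁺ f (x∈p∩q⁺ (c∈A , d∈B))
  back : image f (A ∩ B) ⊆ image f A ∩ image f B
  back y∈ with ∈-image⁻ f (A ∩ B) y∈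
  ... | c , c∈A∩B , refl with x∈p∩q⁻ A B c∈A∩B
  ...   | c∈A , c∈B = x∈p∩q⁺ (∈-image⁺ f c∈A , ∈-image⁺ f c∈B)

-- K5 - e as the union of two 4-cliques

-- With the missing edge {0, 1}, K5 - e is the union of the 4-cliques on
-- Q₀ = Fin 5 - {1} and Q₁ = Fin 5 - {0}, which meet in three vertices.
Q₀ Q₁ : Subset 5
Q₀ = ⊤ - suc zero
Q₁ = ⊤ - zero

∈-⊤-⁺ : ∀ {n} {c : Fin n} x → c ≢ x → c ∈ ⊤ - x
∈-⊤-⁺ x c≢x = x∈p∧x≢y⇒x∈p-y ∈⊤ c≢x

∈-⊤-⁻ : ∀ {n} {c : Fin n} x → c ∈ ⊤ - x → c ≢ x
∈-⊤-⁻ x = x∈p-y⇒x≢y {p = ⊤}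

adjacent⇒common-clique : ∀ {c d} → K5-e-adj c d → (c ∈ Q₀ × d ∈ Q₀) ⊎ (c ∈ Q₁ × d ∈ Q₁)
adjacent⇒common-clique {c} {d} (_ , not-missing) with c ≟ suc zero | d ≟ suc zero
... | yes refl | _        = inj₂ (∈-⊤-⁺ zero (λ ()) , ∈-⊤-⁺ zero λ d≡0 → not-missing (inj₂ (refl , d≡0)))
... | no _     | yes refl = inj₂ (∈-⊤-⁺ zero (λ c≡0 → not-missing (inj₁ (c≡0 , refl))) , ∈-⊤-⁺ zero λ ())
... | no c≢1   | no d≢1   = inj₁ (∈-⊤-⁺ (suc zero) c≢1 , ∈-⊤-⁺ (suc zero) d≢1)

common-clique⇒adjacent : ∀ {c d} → c ≢ d → (c ∈ Q₀ × d ∈ Q₀) ⊎ (c ∈ Q₁ × d ∈ Q₁) → K5-e-adj c d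
common-clique⇒adjacent c≢d (inj₁ (c∈Q₀ , d∈Q₀)) = c≢d , λ
  { (inj₁ (_ , d≡1)) → ∈-⊤-⁻ (suc zero) d∈Q₀ d≡1
  ; (inj₂ (c≡1 , _)) → ∈-⊤-⁻ (suc zero) c∈Q₀ c≡1 }
common-clique⇒adjacent c≢d (inj₂ (c∈Q₁ , d∈Q₁)) = c≢d , λ
  { (inj₁ (c≡0 , _)) → ∈-⊤-⁻ zero c∈Q₁ c≡0
  ; (inj₂ (_ , d≡0)) → ∈-⊤-⁻ zero d∈Q₁ d≡0 }

LeaveClique : ∀ {n k} → (Fin k → Subset n) → Subset n → Set
LeaveClique P S = ∀ {u v} → u ≢ v → u ∈ S → v ∈ S → InLeave P u v

TwinBlocks : ∀ {n k} → (Fin k → Subset n) → Set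
TwinBlocks {n} P = Σ (Subset n) λ S → Σ (Subset n) λ T →
  ∣ S ∣ ≡ 4 × ∣ T ∣ ≡ 4 × ∣ S ∩ T ∣ ≡ 3 × LeaveClique P S × LeaveClique P T

image-clique : ∀ {n k} {P : Fin k → Subset n} {f : Fin 5 → Fin n} →
  (∀ a b → K5-e-adj a b → InLeave P (f a) (f b)) →
  ∀ {A} → (∀ {c d} → c ≢ d → c ∈ A → d ∈ A → K5-e-adj c d) → LeaveClique P (image f A)
image-clique {f = f} embeds {A} clique {u} {v} u≢v u∈ v∈
  with ∈-image⁻ f A u∈ | ∈-image⁻ f A v∈
... | c , c∈A , refl | d , d∈A , refl = embeds c d (clique (λ c≡d → u≢v (cong f c≡d)) c∈A d∈A)

K5-e⇒twins : ∀ {n k} {P : Fin k → Subset n} → LeaveContainsK5-e P → TwinBlocks P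
K5-e⇒twins (f , f-inj , embeds) =
  image f Q₀ , image f Q₁ , ∣image∣ f-inj′ Q₀ , ∣image∣ f-inj′ Q₁ ,
  trans (cong ∣_∣ (image-∩ f-inj′ Q₀ Q₁)) (∣image∣ f-inj′ (Q₀ ∩ Q₁)) ,
  image-clique embeds (λ c≢d c∈ d∈ → common-clique⇒adjacent c≢d (inj₁ (c∈ , d∈))) ,
  image-clique embeds (λ c≢d c∈ d∈ → common-clique⇒adjacent c≢d (inj₂ (c∈ , d∈)))
  where
  f-inj′ : Injective _≡_ _≡_ f
  f-inj′ = f-inj _ _

-- Twin blocks S = {a,x,y,z}, T = {e,x,y,z} span a K5 - e in the leave, sending
-- 0, 1, 2, 3, 4 to a, e, x, y, z: every pair except {a, e} lies inside S or T.
twins⇒K5-e : ∀ {n k} {P : Fin k → Subset n} → TwinBlocks P → LeaveContainsK5-e P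
twins⇒K5-e {n} {P = P} (S , T , ∣S∣≡4 , ∣T∣≡4 , ∣S∩T∣≡3 , S-clique , T-clique)
  with three-members (S ∩ T) (≤-reflexive (sym ∣S∩T∣≡3))
     | ∃-outside S T (subst₂ _<_ (sym ∣S∩T∣≡3) (sym ∣S∣≡4) ≤-refl)
     | ∃-outside T S (subst₂ _<_ (sym (trans (cong ∣_∣ (∩-comm T S)) ∣S∩T∣≡3)) (sym ∣T∣≡4) ≤-refl)
... | x , y , z , x≢y , x≢z , y≢z , x∈S∩T , y∈S∩T , z∈S∩T | a , a∈S , a∉T | e , e∈T , e∉S =
  f , lookup-injective distinct , embeds
  where
  x∈S = proj₁ (x∈p∩q⁻ S T x∈S∩T)
  y∈S = proj₁ (x∈p∩q⁻ S T y∈S∩T)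
  z∈S = proj₁ (x∈p∩q⁻ S T z∈S∩T)
  x∈T = proj₂ (x∈p∩q⁻ S T x∈S∩T)
  y∈T = proj₂ (x∈p∩q⁻ S T y∈S∩T)
  z∈T = proj₂ (x∈p∩q⁻ S T z∈S∩T)

  vertices : Vec (Fin n) 5
  vertices = a ∷ e ∷ x ∷ y ∷ z ∷ []

  f : Fin 5 → Fin n
  f = lookup vertices

  distinct : Unique vertices
  distinct = (∉-∈⇒≢ a∉T e∈T ∷ ∉-∈⇒≢ a∉T x∈T ∷ ∉-∈⇒≢ a∉T y∈T ∷ ∉-∈⇒≢ a∉T z∈T ∷ [])
           ∷ (∉-∈⇒≢ e∉S x∈S ∷ ∉-∈⇒≢ e∉S y∈S ∷ ∉-∈⇒≢ e∉S z∈S ∷ [])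
           ∷ (x≢y ∷ x≢z ∷ []) ∷ (y≢z ∷ []) ∷ [] ∷ []

  f-distinct : ∀ {c d} → c ≢ d → f c ≢ f d
  f-distinct c≢d fc≡fd = c≢d (lookup-injective distinct _ _ fc≡fd)

  Q₀⇒S : ∀ c → c ∈ Q₀ → f c ∈ S
  Q₀⇒S zero                         _    = a∈S
  Q₀⇒S (suc zero)                   1∈Q₀ = contradiction refl (∈-⊤-⁻ (suc zero) 1∈Q₀)
  Q₀⇒S (suc (suc zero))             _    = x∈S
  Q₀⇒S (suc (suc (suc zero)))       _    = y∈S
  Q₀⇒S (suc (suc (suc (suc zero)))) _    = z∈S

  Q₁⇒T : ∀ c → c ∈ Q₁ → f c ∈ T
  Q₁⇒T zero                         0∈Q₁ = contradiction refl (∈-⊤-⁻ zero 0∈Q₁)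
  Q₁⇒T (suc zero)                   _    = e∈T
  Q₁⇒T (suc (suc zero))             _    = x∈T
  Q₁⇒T (suc (suc (suc zero)))       _    = y∈T
  Q₁⇒T (suc (suc (suc (suc zero)))) _    = z∈T

  embeds : ∀ c d → K5-e-adj c d → InLeave P (f c) (f d)
  embeds c d adj@(c≢d , _) with adjacent⇒common-clique adj
  ... | inj₁ (c∈ , d∈) = S-clique (f-distinct c≢d) (Q₀⇒S c c∈) (Q₀⇒S d d∈)
  ... | inj₂ (c∈ , d∈) = T-clique (f-distinct c≢d) (Q₁⇒T c c∈) (Q₁⇒T d d∈)

K5-e⇔twins : ∀ {n k} {P : Fin k → Subset n} → LeaveContainsK5-e P ⇔ TwinBlocks P
K5-e⇔twins = mk⇔ K5-e⇒twins twins⇒K5-e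

-- Deletion: removing the unique triple pair leaves a packing with twin blocks

module Deletion {n k : ℕ} (E : Fin (suc (suc k)) → Subset n) (G : IsFourGraph n (suc (suc k)) E)
  {i j : Fin (suc (suc k))} (∣Ei∩Ej∣≡3 : ∣ E i ∩ E j ∣ ≡ 3)
  (only-ij : ∀ s t → s ≢ t → 2 ≤ ∣ E s ∩ E t ∣ → (s ≡ i × t ≡ j) ⊎ (s ≡ j × t ≡ i))
  (i≢j : i ≢ j) where

  Special : Fin (suc (suc k)) → Set
  Special s = s ≡ i ⊎ s ≡ j

  sharing⇒special : ∀ {s t u v} → s ≢ t → u ≢ v → u ∈ E s → v ∈ E s → u ∈ E t → v ∈ E t → Special s
  sharing⇒special {s} {t} s≢t u≢v u∈s v∈s u∈t v∈t
    with only-ij s t s≢t (pair⇒2≤∣p∣ u≢v (x∈p∩q⁺ (u∈s , u∈t)) (x∈p∩q⁺ (v∈s , v∈t)))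
  ... | inj₁ (s≡i , _) = inj₁ s≡i
  ... | inj₂ (s≡j , _) = inj₂ s≡j

  -- The kept indices, i.e. all indices except i and j, in increasing order.
  keep : Fin k → Fin (suc (suc k))
  keep t = punchIn i (punchIn (punchOut i≢j) t)

  keep-injective : ∀ {s t} → keep s ≡ keep t → s ≡ t
  keep-injective eq = punchIn-injective (punchOut i≢j) _ _ (punchIn-injective i _ _ eq)

  keep-ordinary : ∀ t → ¬ Special (keep t)
  keep-ordinary t (inj₁ keep≡i) = punchInᵢ≢i i _ keep≡i
  keep-ordinary t (inj₂ keep≡j) = punchInᵢ≢i (punchOut i≢j) t
    (punchIn-injective i _ _ (trans keep≡j (sym (punchIn-punchOut i≢j))))

  P : Fin k → Subset n
  P = E ∘ keep

  -- Two distinct kept edges sharing two points would make a kept index special.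
  packing : IsPacking n k P
  packing = ((λ t → proj₁ G (keep t)) , (λ s t Ps≡Pt → keep-injective (proj₂ G _ _ Ps≡Pt))) , at-most-once
    where
    at-most-once : ∀ u v → u ≢ v → ∀ s t → u ∈ P s → v ∈ P s → u ∈ P t → v ∈ P t → s ≡ t
    at-most-once u v u≢v s t u∈s v∈s u∈t v∈t with s ≟ t
    ... | yes s≡t = s≡t
    ... | no s≢t  = contradiction (sharing⇒special (s≢t ∘ keep-injective) u≢v u∈s v∈s u∈t v∈t)
                                  (keep-ordinary s)

  -- A kept edge containing two points of E i (or E j) would make its index special.
  special-clique : ∀ {r} → Special r → LeaveClique P (E r)
  special-clique {r} r-special u≢v u∈r v∈r = u≢v , λ t (u∈t , v∈t) →
    keep-ordinary t (sharing⇒special keep≢r u≢v u∈t v∈t u∈r v∈r)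
    where
    keep≢r : ∀ {t} → keep t ≢ r
    keep≢r {t} refl = keep-ordinary t r-special

  twins : TwinBlocks P
  twins = E i , E j , proj₁ G i , proj₁ G j , ∣Ei∩Ej∣≡3 , special-clique (inj₁ refl) , special-clique (inj₂ refl)

-- Extension: adding twin blocks to a packing creates a unique triple pair

module Extension {n k : ℕ} {P : Fin k → Subset n} (packing : IsPacking n k P)
  {S T : Subset n} (∣S∣≡4 : ∣ S ∣ ≡ 4) (∣T∣≡4 : ∣ T ∣ ≡ 4) (∣S∩T∣≡3 : ∣ S ∩ T ∣ ≡ 3)
  (S-clique : LeaveClique P S) (T-clique : LeaveClique P T) where

  -- Index 0 is S, index 1 is T and index 2 + a is the old block P a.
  old : Fin k → Fin (suc (suc k))
  old a = suc (suc a)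

  E : Fin (suc (suc k)) → Subset n
  E zero          = S
  E (suc zero)    = T
  E (suc (suc a)) = P a

  clique-avoids : ∀ {Q u v} → LeaveClique P Q → u ≢ v → u ∈ Q → v ∈ Q → ∀ a → ¬ (u ∈ P a × v ∈ P a)
  clique-avoids Q-clique u≢v u∈Q v∈Q = proj₂ (Q-clique u≢v u∈Q v∈Q)

  new-block : ∀ {Q} → ∣ Q ∣ ≡ 4 → LeaveClique P Q → ∀ a → P a ≢ Q
  new-block {Q} ∣Q∣≡4 Q-clique a refl with two-members Q (subst (2 ≤_) (sym ∣Q∣≡4) (s≤s (s≤s z≤n)))
  ... | u , v , u≢v , u∈Q , v∈Q = clique-avoids Q-clique u≢v u∈Q v∈Q a (u∈Q , v∈Q)

  S≢T : S ≢ T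
  S≢T refl with () ← trans (sym ∣S∣≡4) (trans (cong ∣_∣ (sym (∩-idem S))) ∣S∩T∣≡3)

  sizes : ∀ s → ∣ E s ∣ ≡ 4
  sizes zero          = ∣S∣≡4
  sizes (suc zero)    = ∣T∣≡4
  sizes (suc (suc a)) = proj₁ (proj₁ packing) a

  injective : ∀ s t → E s ≡ E t → s ≡ t
  injective zero          zero          _   = refl
  injective (suc zero)    (suc zero)    _   = refl
  injective zero          (suc zero)    S≡T = contradiction S≡T S≢T
  injective (suc zero)    zero          T≡S = contradiction (sym T≡S) S≢T
  injective zero          (suc (suc a)) S≡P = contradiction (sym S≡P) (new-block ∣S∣≡4 S-clique a)
  injective (suc zero)    (suc (suc a)) T≡P = contradiction (sym T≡P) (new-block ∣T∣≡4 T-clique a)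
  injective (suc (suc a)) zero          P≡S = contradiction P≡S (new-block ∣S∣≡4 S-clique a)
  injective (suc (suc a)) (suc zero)    P≡T = contradiction P≡T (new-block ∣T∣≡4 T-clique a)
  injective (suc (suc a)) (suc (suc b)) P≡P = cong old (proj₂ (proj₁ packing) a b P≡P)

  -- Two distinct edges sharing two points are S and T: an old block shares at most
  -- one point with another old block (packing) and with S or T (leave cliques).
  sharing⇒twins : ∀ s t → s ≢ t → ∀ {u v} → u ≢ v → u ∈ E s → v ∈ E s → u ∈ E t → v ∈ E t →
    (s ≡ zero × t ≡ suc zero) ⊎ (s ≡ suc zero × t ≡ zero)
  sharing⇒twins zero       zero       s≢t _ _ _ _ _ = contradiction refl s≢t
  sharing⇒twins (suc zero) (suc zero) s≢t _ _ _ _ _ = contradiction refl s≢t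
  sharing⇒twins zero       (suc zero) _   _ _ _ _ _ = inj₁ (refl , refl)
  sharing⇒twins (suc zero) zero       _   _ _ _ _ _ = inj₂ (refl , refl)
  sharing⇒twins zero (suc (suc a)) _ u≢v u∈S v∈S u∈a v∈a =
    contradiction (u∈a , v∈a) (clique-avoids S-clique u≢v u∈S v∈S a)
  sharing⇒twins (suc zero) (suc (suc a)) _ u≢v u∈T v∈T u∈a v∈a =
    contradiction (u∈a , v∈a) (clique-avoids T-clique u≢v u∈T v∈T a)
  sharing⇒twins (suc (suc a)) zero _ u≢v u∈a v∈a u∈S v∈S =
    contradiction (u∈a , v∈a) (clique-avoids S-clique u≢v u∈S v∈S a)
  sharing⇒twins (suc (suc a)) (suc zero) _ u≢v u∈a v∈a u∈T v∈T =
    contradiction (u∈a , v∈a) (clique-avoids T-clique u≢v u∈T v∈T a)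
  sharing⇒twins (suc (suc a)) (suc (suc b)) s≢t u≢v u∈a v∈a u∈b v∈b =
    contradiction (cong old (proj₂ packing _ _ u≢v a b u∈a v∈a u∈b v∈b)) s≢t

  unique-triple : UniqueTriplePair E
  unique-triple = zero , suc zero , (λ ()) , ∣S∩T∣≡3 , only-twins
    where
    only-twins : ∀ s t → s ≢ t → 2 ≤ ∣ E s ∩ E t ∣ →
      (s ≡ zero × t ≡ suc zero) ⊎ (s ≡ suc zero × t ≡ zero)
    only-twins s t s≢t 2≤ with two-members (E s ∩ E t) 2≤
    ... | u , v , u≢v , u∈ , v∈ with x∈p∩q⁻ (E s) (E t) u∈ | x∈p∩q⁻ (E s) (E t) v∈
    ...   | u∈s , u∈t | v∈s , v∈t = sharing⇒twins s t s≢t u≢v u∈s v∈s u∈t v∈t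

TripleFourGraph : ℕ → ℕ → Set
TripleFourGraph n m = Σ (Fin m → Subset n) λ E → IsFourGraph n m E × UniqueTriplePair E

K5-ePacking : ℕ → ℕ → Set
K5-ePacking n k = Σ (Fin k → Subset n) λ P → IsPacking n k P × LeaveContainsK5-e P

-- A unique triple pair needs two distinct edges, so m = k + 2.
delete-triple-pair : ∀ {n m} → TripleFourGraph n m → Σ ℕ λ k → k + 2 ≡ m × K5-ePacking n k
delete-triple-pair {m = zero}        (_ , _ , () , _)
delete-triple-pair {m = suc zero}    (_ , _ , zero , zero , 0≢0 , _) = contradiction refl 0≢0
delete-triple-pair {m = suc (suc k)} (E , G , i , j , i≢j , ∣Ei∩Ej∣≡3 , only-ij) =
  k , +-comm k 2 , P , packing , Equivalence.from K5-e⇔twins twins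
  where open Deletion E G ∣Ei∩Ej∣≡3 only-ij i≢j

add-twin-blocks : ∀ {n k} → K5-ePacking n k → TripleFourGraph n (k + 2)
add-twin-blocks {n} {k} (P , packing , K5-e) with Equivalence.to K5-e⇔twins K5-e
... | S , T , ∣S∣≡4 , ∣T∣≡4 , ∣S∩T∣≡3 , S-clique , T-clique =
  subst (TripleFourGraph n) (+-comm 2 k) (E , (sizes , injective) , unique-triple)
  where open Extension packing ∣S∣≡4 ∣T∣≡4 ∣S∩T∣≡3 S-clique T-clique

lemma3p4 : (n m : ℕ) →
    (Σ (Fin m → Subset n) λ E → IsFourGraph n m E × UniqueTriplePair E)
    ⇔ (Σ ℕ λ k → k + 2 ≡ m × Σ (Fin k → Subset n) λ P → IsPacking n k P × LeaveContainsK5-e P)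
lemma3p4 n m = mk⇔ delete-triple-pair λ { (k , refl , packing) → add-twin-blocks packing }
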